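{- Let $G$ be a graph and let $U\subset V(G)$ be a concentrated vertex set of finite adhesion such that $\partial U$ is a compact subset of the end space $\Omega(G)$. Let $(\varepsilon_n)_{n\in\mathbb N}$ be a sequence of ends in $\Omega(G)\setminus\partial U$, and let $D_n$ be the unique component of $G-U$ in which $\varepsilon_n$ lives (i.e. which contains a tail of every ray in $\varepsilon_n$). Then $\varepsilon_n\to\partial U$ as $n\to\infty$ if and only if the map $\mathbb N\ni n\mapsto N_G(D_n)$ is finite-to-one.
   Context: Ends: a ray is a one-way infinite path; two rays are equivalent if for every finite $X\subset V(G)$ they have tails in the same component of $G-X$; the classes are the ends, forming $\Omega(G)$. For finite $X$ and an end $\varepsilon$, $C(X,\varepsilon)$ is the component of $G-X$ containing tails of all rays of $\varepsilon$. $\Omega(G)$ carries the topology with basic open sets $\{\varepsilon : C(X,\varepsilon)=C\}$ for finite $X$ and components $C$ of $G-X$. $\partial M$ is the set of ends $\varepsilon$ such that $C(X,\varepsilon)$ meets $M$ for every finite $X$. $U$ has finite adhesion if $N(C)$ is finite for every component $C$ of $G-U$. $U$ is concentrated if for every finite $X\subset V(G)$ only finitely many vertices of $U$ lie outside $\bigcup_{\varepsilon\in\partial U}C(X,\varepsilon)$. A sequence $x_n$ converges to a set $A$ if every open set containing $A$ contains all but finitely many $x_n$. A map is finite-to-one if all its fibres are finite. -}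

module Defs where

open import Level using (0ℓ)
open import Data.Nat using (ℕ; suc; _≤_; _<_)
open import Data.Product using (Σ; ∃; _×_; _,_)
open import Data.List using (List)
open import Data.List.Membership.Propositional using (_∈_)
open import Relation.Nullary using (¬_)
open import Relation.Binary.PropositionalEquality using (_≡_)
open import Function.Bundles using (_⇔_)

record Graph : Set₁ where
  field
    V       : Set
    _~_     : V → V → Set
    sym~    : ∀ {u v} → u ~ v → v ~ u
    irrefl~ : ∀ {v} → ¬ (v ~ v)

module _ (G : Graph) where
  open Graph G

  VSet : Set₁
  VSet = V → Set

  _∉ˡ_ : V → List V → Set
  v ∉ˡ X = ¬ (v ∈ X)

  asSet : List V → VSet
  asSet X v = v ∈ X

  -- Conn P u v : u and v lie in the same component of G - P
  -- (there is a u–v path all of whose vertices avoid P).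
  data Conn (P : VSet) : V → V → Set where
    here : ∀ {v} → ¬ P v → Conn P v v
    step : ∀ {u w v} → ¬ P u → u ~ w → Conn P w v → Conn P u v

  record Ray : Set where
    field
      r   : ℕ → V
      inj : ∀ {m n} → r m ≡ r n → m ≡ n
      adj : ∀ n → r n ~ r (suc n)
  open Ray public

  TailIn : VSet → Ray → V → Set
  TailIn P R w = Σ ℕ λ N → ∀ n → N ≤ n → Conn P (r R n) w

  -- Equivalence of rays; ends are its classes.  Ends are represented by
  -- rays and every notion below is invariant under this equivalence.
  _≈ʳ_ : Ray → Ray → Set
  R ≈ʳ S = ∀ (X : List V) → ∃ λ w → TailIn (asSet X) R w × TailIn (asSet X) S w

  EndSet : Set₁
  EndSet = Ray → Set

  InC : List V → Ray → V → Set
  InC X R w = TailIn (asSet X) R w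

  ∂ : VSet → EndSet
  ∂ M R = ∀ (X : List V) → ∃ λ u → M u × InC X R u

  NComp : VSet → V → VSet
  NComp P w v = ¬ Conn P v w × ∃ λ x → (v ~ x) × Conn P x w

  FiniteAdhesion : VSet → Set
  FiniteAdhesion U = ∀ w → ¬ U w →
    ∃ λ (L : List V) → ∀ v → NComp U w v → v ∈ L

  Concentrated : VSet → Set
  Concentrated U = ∀ (X : List V) → ∃ λ (L : List V) →
    ∀ u → U u → (∀ R → ∂ U R → ¬ InC X R u) → u ∈ L

  -- A family of basic open sets {ε : C(X_i,ε) = C_i} of Ω(G), where C_i is
  -- the component of G - X_i containing the vertex c_i.  Open sets of Ω(G)
  -- are exactly the unions of such families.
  record BasicFamily : Set₁ where
    field
      I : Set
      X : I → List V
      c : I → V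
  open BasicFamily public

  InFam : BasicFamily → Ray → Set
  InFam F R = ∃ λ i → InC (X F i) R (c F i)

  Covers : BasicFamily → EndSet → Set
  Covers F A = ∀ R → A R → InFam F R

  Compact : EndSet → Set₁
  Compact A = ∀ (F : BasicFamily) → Covers F A →
    ∃ λ (is : List (I F)) → ∀ R → A R → ∃ λ i → i ∈ is × InC (X F i) R (c F i)

  ConvergesTo : (ℕ → Ray) → EndSet → Set₁
  ConvergesTo ε A = ∀ (F : BasicFamily) → Covers F A →
    ∃ λ N → ∀ n → N ≤ n → InFam F (ε n)

  NbdOfCompOf : VSet → Ray → VSet
  NbdOfCompOf U R v = ∃ λ w → TailIn U R w × NComp U w v

-- A map ℕ → (vertex sets) is finite-to-one: every fibre (w.r.t. equality
-- of sets) is finite, i.e. bounded.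
FiniteToOne : {A : Set} → (ℕ → (A → Set)) → Set
FiniteToOne f = ∀ n → ∃ λ B → ∀ m → (∀ a → f m a ⇔ f n a) → m < B

{-# OPTIONS --safe #-}
module Submission where

-- An end ε ∉ ∂U lives in a component D of G − U, whose neighbourhood N(D) is finite.
-- (⇒) A path in G − N(D) from D to U would have to leave D through N(D); so no end of D
-- lies in the neighbourhood ⋃_{ε ∈ ∂U} C(N(D), ε) of ∂U, and convergence leaves only
-- finitely many n with N(D_n) = N(D).
-- (⇐) Compactness turns an open cover of ∂U into a finite subcover whose separators lie in a
-- finite Y, and concentration gives a finite L ⊆ U containing every vertex of U outside all
-- C(Y, ε), ε ∈ ∂U.  If ε_n is not covered, then either D_n meets Y, or N(D_n) ⊆ Y ∪ L: a
-- neighbour v ∉ Y ∪ L lies in some C(Y, ε) with ε ∈ ∂U, and D_n + v is connected in G − Y,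
-- so ε_n would lie there too.  Hence the uncovered ε_n realise only finitely many N(D_n).

open import Defs
open import Level using (0ℓ)
open import Data.Nat using (ℕ; suc; _≤_; _<_; _⊔_; _≤′_; ≤′-refl; ≤′-step; _≤?_)
open import Data.Nat.Properties
  using (≤-refl; ≤-reflexive; ≤-trans; m≤m⊔n; m≤n⊔m; <-≤-trans; <⇒≱; ≰⇒>; ≤⇒≤′; ≤′⇒≤; n≮n)
open import Data.Product using (Σ; ∃; _×_; _,_; proj₁; proj₂)
open import Data.Empty using (⊥-elim)
open import Data.List using (List; []; _∷_; [_]; _++_; map; concatMap; filter)
open import Data.List.Extrema.Nat using (max; xs≤max)
open import Data.List.Relation.Unary.All using (lookup)
open import Data.List.Relation.Unary.Any as Any using ()
open import Data.List.Membership.Propositional using (_∈_)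
open import Data.List.Membership.Propositional.Properties
  using (∈-++⁺ˡ; ∈-++⁺ʳ; ∈-map⁺; ∈-concatMap⁺; ∈-filter⁺; ∈-filter⁻)
open import Relation.Nullary using (¬_; yes; no)
open import Relation.Unary using (Decidable)
open import Relation.Binary.PropositionalEquality using (_≡_; _≢_; refl; sym; trans)
open import Function.Base using (_∘_)
open import Function.Bundles using (_⇔_; mk⇔; Equivalence)
open import Function.Construct.Composition using (_⇔-∘_)
open import Function.Construct.Symmetry using (⇔-sym)
open import Axiom.ExcludedMiddle using (ExcludedMiddle)
open import Axiom.DoubleNegationElimination using (em⇒dne)

Eventually : (ℕ → Set) → Set
Eventually P = ∃ λ N → ∀ n → N ≤ n → P n

Eventually-zip : ∀ {P Q} → Eventually P → Eventually Q → Eventually (λ n → P n × Q n)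
Eventually-zip (M , p) (N , q) =
  M ⊔ N , λ n le → p n (≤-trans (m≤m⊔n M N) le) , q n (≤-trans (m≤n⊔m M N) le)

Eventually-witness : ∀ {P} → Eventually P → ∃ P
Eventually-witness (N , p) = N , p N ≤-refl

Eventually-∀∈ : {A : Set} {P : A → ℕ → Set} (xs : List A) →
  (∀ x → x ∈ xs → Eventually (P x)) → Eventually (λ n → ∀ x → x ∈ xs → P x n)
Eventually-∀∈ [] _ = 0 , λ _ _ _ ()
Eventually-∀∈ (x ∷ xs) ev
  with Eventually-zip (ev x (Any.here refl)) (Eventually-∀∈ xs (λ y → ev y ∘ Any.there))
... | N , p = N , λ { n le y (Any.here refl) → proj₁ (p n le)
                    ; n le y (Any.there y∈xs) → proj₂ (p n le) y y∈xs }

sublists : {A : Set} → List A → List (List A)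
sublists [] = [ [] ]
sublists (x ∷ xs) = map (x ∷_) (sublists xs) ++ sublists xs

filter-∈-sublists : {A : Set} {P : A → Set} (P? : Decidable P) (xs : List A) → filter P? xs ∈ sublists xs
filter-∈-sublists P? [] = Any.here refl
filter-∈-sublists P? (x ∷ xs) with P? x
... | yes _ = ∈-++⁺ˡ (∈-map⁺ (x ∷_) (filter-∈-sublists P? xs))
... | no _ = ∈-++⁺ʳ _ (filter-∈-sublists P? xs)

Represents : {A : Set} → List ℕ → List A → (A → ℕ → Set) → Set
Represents ks xs R = ∀ {x n} → x ∈ xs → R x n → ∃ λ k → k ∈ ks × R x k

FiniteToOne-bound : {A : Set} {f : ℕ → A → Set} → FiniteToOne f → (ks : List ℕ) →
  ∃ λ B → ∀ {n k} → k ∈ ks → (∀ a → f n a ⇔ f k a) → n < B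
FiniteToOne-bound fto ks =
  max 0 (map B ks) , λ {n} {k} k∈ks same →
    <-≤-trans (proj₂ (fto k) n same) (lookup (xs≤max 0 (map B ks)) (∈-map⁺ B k∈ks))
  where
    B : ℕ → ℕ
    B = proj₁ ∘ fto

module _ {G : Graph} where
  open Graph G

  Conn-head : ∀ {P a b} → Conn G P a b → ¬ P a
  Conn-head (here p) = p
  Conn-head (step p _ _) = p

  Conn-trans : ∀ {P a b c} → Conn G P a b → Conn G P b c → Conn G P a c
  Conn-trans (here _) bc = bc
  Conn-trans (step p e ab) bc = step p e (Conn-trans ab bc)

  Conn-sym : ∀ {P a b} → Conn G P a b → Conn G P b a
  Conn-sym (here p) = here p
  Conn-sym (step p e ab) = Conn-trans (Conn-sym ab) (step (Conn-head ab) (sym~ e) (here p))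

  Conn-mono : ∀ {P Q : VSet G} {a b} → (∀ v → Q v → P v) → Conn G P a b → Conn G Q a b
  Conn-mono Q⊆P (here p) = here (p ∘ Q⊆P _)
  Conn-mono Q⊆P (step p e ab) = step (p ∘ Q⊆P _) e (Conn-mono Q⊆P ab)

  Conn-retarget : ∀ {P Q : VSet G} {a b} → (∀ y → Conn G P y b → ¬ Q y) → Conn G P a b → Conn G Q a b
  Conn-retarget avoids (here p) = here (avoids _ (here p))
  Conn-retarget avoids (step p e ab) = step (avoids _ (step p e ab)) e (Conn-retarget avoids ab)

  TailIn-Conn : ∀ {P R w w'} → TailIn G P R w → TailIn G P R w' → Conn G P w w'
  TailIn-Conn t t' with Eventually-witness (Eventually-zip t t')
  ... | _ , c , c' = Conn-trans (Conn-sym c) c'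

  InC-mono : ∀ {X Y : List V} {R S a c} → (∀ v → v ∈ X → v ∈ Y) →
    InC G Y R a → InC G Y S a → InC G X S c → InC G X R c
  InC-mono X⊆Y (M , RY) SY (N , SX) = M , λ n le →
    let _ , Sm-a , Sm-c = Eventually-witness (Eventually-zip SY (N , SX))
    in Conn-trans (Conn-mono X⊆Y (Conn-trans (RY n le) (Conn-sym Sm-a))) Sm-c

  avoiding-ray-TailIn : ∀ {P} (R : Ray G) N → (∀ n → N ≤ n → ¬ P (r R n)) → TailIn G P R (r R N)
  avoiding-ray-TailIn {P} R N avoids = N , λ n → walk ∘ ≤⇒≤′
    where
      walk : ∀ {n} → N ≤′ n → Conn G P (r R n) (r R N)
      walk ≤′-refl = here (avoids N ≤-refl)
      walk (≤′-step le) = step (avoids _ (≤′⇒≤ (≤′-step le))) (sym~ (adj R _)) (walk le)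

  finite-subcover-vertices : ∀ {A : EndSet G} (F : BasicFamily G) → Compact G A → Covers G F A →
    ∃ λ (Y : List V) → ∀ S → A S → ∃ λ i → (∀ v → v ∈ X F i → v ∈ Y) × InC G (X F i) S (c F i)
  finite-subcover-vertices F compact cover with compact F cover
  ... | is , subcover = concatMap (X F) is , λ S S∈A →
    let i , i∈is , SXc = subcover S S∈A
    in i , (λ v v∈Xi → ∈-concatMap⁺ (X F) (Any.map (λ { refl → v∈Xi }) i∈is)) , SXc

  NComp-cong : ∀ {P w w' v} → Conn G P w w' → NComp G P w v ⇔ NComp G P w' v
  NComp-cong ww' = mk⇔ (move ww') (move (Conn-sym ww'))
    where
      move : ∀ {P w w' v} → Conn G P w w' → NComp G P w v → NComp G P w' v
      move ww' (¬vw , x , vx , xw) = (λ vw' → ¬vw (Conn-trans vw' (Conn-sym ww'))) , x , vx , Conn-trans xw ww'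

  NbdOfCompOf⇔NComp : ∀ {U R w} → TailIn G U R w → ∀ v → NbdOfCompOf G U R v ⇔ NComp G U w v
  NbdOfCompOf⇔NComp {R = R} t v = mk⇔
    (λ (_ , t' , nc) → Equivalence.to (NComp-cong (TailIn-Conn {R = R} t' t)) nc)
    (λ nc → _ , t , nc)

  Conn-to-neighbour : ∀ {U Y : VSet G} {a w v} → (∀ y → Conn G U y w → ¬ Y y) →
    NComp G U w v → ¬ Y v → Conn G U a w → Conn G Y a v
  Conn-to-neighbour avoids (_ , x , vx , xw) ¬Yv aw =
    Conn-trans (Conn-retarget avoids aw)
               (Conn-trans (Conn-sym (Conn-retarget avoids xw)) (step (avoids _ xw) (sym~ vx) (here ¬Yv)))

module Classical (em : ExcludedMiddle 0ℓ) where

  dne : {P : Set} → ¬ ¬ P → P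
  dne = em⇒dne em

  representatives : {A : Set} (xs : List A) (R : A → ℕ → Set) → ∃ λ ks → Represents ks xs R
  representatives [] R = [] , λ ()
  representatives (x ∷ xs) R with representatives xs R | em {∃ (R x)}
  ... | ks , rep | yes (k , Rxk) = k ∷ ks , λ
      { (Any.here refl) _ → k , Any.here refl , Rxk
      ; (Any.there y∈xs) Ryn → let k' , k'∈ks , Ryk' = rep y∈xs Ryn in k' , Any.there k'∈ks , Ryk' }
  ... | ks , rep | no ¬Rx = ks , λ
      { (Any.here refl) Rxn → ⊥-elim (¬Rx (_ , Rxn))
      ; (Any.there y∈xs) Ryn → rep y∈xs Ryn }

  ⊆-sublists : {A : Set} {xs : List A} (P : A → Set) → (∀ v → P v → v ∈ xs) →
    ∃ λ T → T ∈ sublists xs × ∀ v → P v ⇔ v ∈ T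
  ⊆-sublists {xs = xs} P P⊆xs = filter P? xs , filter-∈-sublists P? xs ,
    λ v → mk⇔ (λ Pv → ∈-filter⁺ P? (P⊆xs v Pv) Pv) (proj₂ ∘ ∈-filter⁻ P? {xs = xs})
    where
      P? : Decidable P
      P? _ = em

  module _ {G : Graph} where
    open Graph G

    ray-eventually-avoids : (R : Ray G) (X : List V) → Eventually (λ n → ¬ r R n ∈ X)
    ray-eventually-avoids R X with Eventually-∀∈ X (λ x _ → misses x)
      where
        misses : ∀ x → Eventually (λ n → r R n ≢ x)
        misses x with em {∃ λ k → r R k ≡ x}
        ... | yes (k , Rk≡x) = suc k , λ n k<n Rn≡x →
          n≮n k (≤-trans k<n (≤-reflexive (inj R (trans Rn≡x (sym Rk≡x)))))
        ... | no never = 0 , λ n _ Rn≡x → never (n , Rn≡x)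
    ... | N , avoids = N , λ n le Rn∈X → avoids n le (r R n) Rn∈X refl

    end-component : ∀ {U : VSet G} (R : Ray G) → ¬ ∂ G U R → ∃ λ w → TailIn G U R w
    end-component {U} R R∉∂U with em {∃ λ X → ¬ (∃ λ u → U u × InC G X R u)}
    ... | no ¬sep = ⊥-elim (R∉∂U (λ X → dne (λ none → ¬sep (X , none))))
    ... | yes (X , sep) with ray-eventually-avoids R X
    ... | N , avoidsX = r R N , avoiding-ray-TailIn R N avoidsU
      where
        avoidsU : ∀ n → N ≤ n → ¬ U (r R n)
        avoidsU n le Un = sep (r R n , Un ,
          avoiding-ray-TailIn R n (λ m n≤m → avoidsX m (≤-trans le n≤m)))

    NComp-∈ : ∀ {U : VSet G} {w v} → NComp G U w v → U v
    NComp-∈ (¬vw , x , vx , xw) = dne (λ ¬Uv → ¬vw (step ¬Uv vx xw))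

    Conn-exit : ∀ {P U : VSet G} {a u w} → Conn G P a u → U u → Conn G U a w →
      ∃ λ y → ¬ P y × NComp G U w y
    Conn-exit (here _) Uu aw = ⊥-elim (Conn-head aw Uu)
    Conn-exit {U = U} (step {w = b} _ ab bu) Uu aw with em {U b}
    ... | yes Ub = b , Conn-head bu , (λ bw → Conn-head bw Ub) , _ , sym~ ab , aw
    ... | no ¬Ub = Conn-exit bu Uu (step ¬Ub (sym~ ab) aw)

    NComp-separates : ∀ {U : VSet G} {L : List V} {R w u} → TailIn G U R w →
      (∀ v → NComp G U w v → v ∈ L) → U u → ¬ InC G L R u
    NComp-separates tU N⊆L Uu tL with Eventually-witness (Eventually-zip tL tU)
    ... | _ , au , aw with Conn-exit au Uu aw
    ... | y , y∉L , y∈N = y∉L (N⊆L y y∈N)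

    NComp-⊆-unless-covered : ∀ {U : VSet G} {Y L : List V} {R w} (F : BasicFamily G) →
      (∀ S → ∂ G U S → ∃ λ i → (∀ v → v ∈ X F i → v ∈ Y) × InC G (X F i) S (c F i)) →
      (∀ u → U u → (∀ S → ∂ G U S → ¬ InC G Y S u) → u ∈ L) →
      TailIn G U R w → (∀ y → Conn G U y w → ¬ y ∈ Y) → ¬ InFam G F R →
      ∀ v → NComp G U w v → v ∈ Y ++ L
    NComp-⊆-unless-covered {Y = Y} {L} {R} F cover concentrated (N , tail) avoidsY R∉F v v∈N
      with em {v ∈ Y} | em {v ∈ L}
    ... | yes v∈Y | _ = ∈-++⁺ˡ v∈Y
    ... | no _ | yes v∈L = ∈-++⁺ʳ Y v∈L
    ... | no v∉Y | no v∉L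
      with dne (λ none → v∉L (concentrated v (NComp-∈ v∈N) λ S S∈∂ Sv → none (S , S∈∂ , Sv)))
    ... | S , S∈∂U , SYv with cover S S∈∂U
    ... | i , Xi⊆Y , SXc = ⊥-elim (R∉F (i , InC-mono {X = X F i} {Y} {R} {S} {v} {c F i} Xi⊆Y RYv SYv SXc))
      where
        RYv : InC G Y R v
        RYv = N , λ n le → Conn-to-neighbour avoidsY v∈N v∉Y (tail n le)

  module _ {G : Graph} {U : VSet G} (ε : ℕ → Ray G) (ε∉∂U : ∀ n → ¬ ∂ G U (ε n)) where
    open Graph G

    w : ℕ → V
    w n = proj₁ (end-component (ε n) (ε∉∂U n))

    ε-in-w : ∀ n → TailIn G U (ε n) (w n)
    ε-in-w n = proj₂ (end-component (ε n) (ε∉∂U n))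

    w∉U : ∀ n → ¬ U (w n)
    w∉U n = Conn-head (Conn-sym (proj₂ (ε-in-w n) _ ≤-refl))

    Nbd : ℕ → VSet G
    Nbd n = NbdOfCompOf G U (ε n)

    Nbd⇔NComp : ∀ n v → Nbd n v ⇔ NComp G U (w n) v
    Nbd⇔NComp n = NbdOfCompOf⇔NComp {R = ε n} (ε-in-w n)

    same-component⇒same-Nbd : ∀ {m n} → Conn G U (w m) (w n) → ∀ v → Nbd m v ⇔ Nbd n v
    same-component⇒same-Nbd {m} {n} wmn v = ⇔-sym (Nbd⇔NComp n v) ⇔-∘ (NComp-cong wmn ⇔-∘ Nbd⇔NComp m v)

    convergent⇒FiniteToOne : FiniteAdhesion G U → ConvergesTo G ε (∂ G U) → FiniteToOne Nbd
    convergent⇒FiniteToOne adhesion convergent n with adhesion (w n) (w∉U n)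
    ... | L , NComp⊆L with convergent F (λ S S∈∂U → (S , S∈∂U) , proj₂ (proj₂ (S∈∂U L)))
      where
        F : BasicFamily G
        F = record { I = Σ (Ray G) (∂ G U) ; X = λ _ → L ; c = λ (S , S∈∂U) → proj₁ (S∈∂U L) }
    ... | M , eventually-in-F = M , below-M
      where
        below-M : ∀ m → (∀ v → Nbd m v ⇔ Nbd n v) → m < M
        below-M m same with M ≤? m
        ... | no M≰m = ≰⇒> M≰m
        ... | yes M≤m with eventually-in-F m M≤m
        ... | (S , S∈∂U) , εm-near-S = ⊥-elim (NComp-separates {L = L} {R = ε m} (ε-in-w m)
              (λ v → NComp⊆L v ∘ Equivalence.to (Nbd⇔NComp n v) ∘ Equivalence.to (same v)
                               ∘ Equivalence.from (Nbd⇔NComp m v))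
              (proj₁ (proj₂ (S∈∂U L))) εm-near-S)

    FiniteToOne⇒convergent : Concentrated G U → Compact G (∂ G U) →
      FiniteToOne Nbd → ConvergesTo G ε (∂ G U)
    FiniteToOne⇒convergent concentrated compact fto F cover =
      B , λ n B≤n → dne (λ εn∉F → <⇒≱ (below-B n εn∉F) B≤n)
      where
        Y : List V
        Y = proj₁ (finite-subcover-vertices F compact cover)

        L : List V
        L = proj₁ (concentrated Y)

        Uncovered : ℕ → Set
        Uncovered n = ¬ InFam G F (ε n)

        Meets : ℕ → Set
        Meets n = ∃ λ y → y ∈ Y × Conn G U y (w n)

        Joined : V → ℕ → Set
        Joined y n = Uncovered n × Conn G U y (w n)

        Spans : List V → ℕ → Set
        Spans T n = Uncovered n × ∀ v → Nbd n v ⇔ v ∈ T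

        meeting : ∃ λ ks → Represents ks Y Joined
        meeting = representatives Y Joined

        avoiding : ∃ λ ks → Represents ks (sublists (Y ++ L)) Spans
        avoiding = representatives (sublists (Y ++ L)) Spans

        ks : List ℕ
        ks = proj₁ meeting ++ proj₁ avoiding

        B : ℕ
        B = proj₁ (FiniteToOne-bound fto ks)

        Nbd-⊆ : ∀ n → Uncovered n → ¬ Meets n → ∀ v → Nbd n v → v ∈ Y ++ L
        Nbd-⊆ n εn∉F disjoint v v∈N = NComp-⊆-unless-covered {Y = Y} {L} {ε n} F
          (proj₂ (finite-subcover-vertices F compact cover)) (proj₂ (concentrated Y)) (ε-in-w n)
          (λ y yw y∈Y → disjoint (y , y∈Y , yw)) εn∉F v (Equivalence.to (Nbd⇔NComp n v) v∈N)

        representative : ∀ n → Uncovered n → ∃ λ k → k ∈ ks × ∀ v → Nbd n v ⇔ Nbd k v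
        representative n εn∉F with em {Meets n}
        ... | yes (y , y∈Y , yw) with proj₂ meeting y∈Y (εn∉F , yw)
        ... | k , k∈ks , _ , yk = k , ∈-++⁺ˡ k∈ks , same-component⇒same-Nbd (Conn-trans (Conn-sym yw) yk)
        representative n εn∉F | no disjoint with ⊆-sublists (Nbd n) (Nbd-⊆ n εn∉F disjoint)
        ... | T , T∈sublists , NbdnT with proj₂ avoiding T∈sublists (εn∉F , NbdnT)
        ... | k , k∈ks , _ , NbdkT =
          k , ∈-++⁺ʳ (proj₁ meeting) k∈ks , λ v → ⇔-sym (NbdkT v) ⇔-∘ NbdnT v

        below-B : ∀ n → Uncovered n → n < B
        below-B n εn∉F with representative n εn∉F
        ... | k , k∈ks , same = proj₂ (FiniteToOne-bound fto ks) k∈ks same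

lemma3p3 : ExcludedMiddle 0ℓ →
    (G : Graph) → (U : Graph.V G → Set) →
    Concentrated G U → FiniteAdhesion G U → Compact G (∂ G U) →
    (ε : ℕ → Ray G) → (∀ n → ¬ ∂ G U (ε n)) →
    (ConvergesTo G ε (∂ G U) ⇔ FiniteToOne (λ n → NbdOfCompOf G U (ε n)))
lemma3p3 em G U concentrated adhesion compact ε ε∉∂U =
  mk⇔ (convergent⇒FiniteToOne {U = U} ε ε∉∂U adhesion)
      (FiniteToOne⇒convergent {U = U} ε ε∉∂U concentrated compact)
  where open Classical em
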